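{- Let $n\ge 1$ and $k\ge 1$. For a permutation $\pi$ of size $n$ with exactly $k$ runs, let $w(\pi)=r_{\pi^{ -1}(1)}r_{\pi^{ -1}(2)}\ldots r_{\pi^{ -1}(n)}\in\{1,\dots,k\}^n$, where $r_p$ denotes the index (counted from the left, starting at $1$) of the run of $\pi$ containing position $p$. Then: (1) the map $\pi\mapsto w(\pi)$ is injective; (2) it induces a bijection between the permutations of size $n$ with exactly $k$ runs and the words in $\{1,\dots,k\}^n$ in which, for each $j$ with $1\le j\le k-1$, some occurrence of $j+1$ precedes some occurrence of $j$; (3) it induces a bijection between the pop-stacked permutations of size $n$ with exactly $k$ runs and the words in $\{1,\dots,k\}^n$ in which, for each $j$ with $1\le j\le k-1$, some occurrence of $j+1$ precedes some occurrence of $j$ and also some occurrence of $j$ precedes some occurrence of $j+1$.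
   Context: For a permutation $\pi=a_1\ldots a_n$, the runs are the maximal increasing strings of consecutive entries (the permutation is split into runs at its descents, i.e. indices $i$ with $a_i>a_{i+1}$); falls are the maximal decreasing strings of consecutive entries. The flip $T$ reverses every fall of a permutation in place. A permutation is pop-stacked if it equals $T(\pi)$ for some permutation $\pi$; equivalently, for every pair of adjacent runs $(R_i,R_{i+1})$ one has $\min(R_i)<\max(R_{i+1})$. -}

module Defs where

open import Data.Nat using (ℕ; zero; suc; _+_; _∸_; _<_; _≤_; _<ᵇ_; _<?_)
open import Data.Bool using (Bool; true; false; if_then_else_; _∧_)
open import Data.Fin using (Fin; toℕ; fromℕ<)
open import Data.Fin.Permutation using (Permutation′; _⟨$⟩ʳ_; _⟨$⟩ˡ_)
open import Data.Vec using (Vec; tabulate; lookup)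
open import Data.Product using (Σ; ∃; _×_)
open import Relation.Nullary using (yes; no)
open import Relation.Binary.PropositionalEquality using (_≡_)

-- One-line notation a_0 a_1 ... a_(n-1) of a permutation (positions and values
-- 0-based), extended by 0 outside the range [0, n).
oneLine : ∀ {n} → Permutation′ n → ℕ → ℕ
oneLine {n} π i with i <? n
... | yes p = toℕ (π ⟨$⟩ʳ fromℕ< p)
... | no _  = 0

dcount : (ℕ → ℕ) → ℕ → ℕ
dcount a zero    = 0
dcount a (suc p) = dcount a p + (if a (suc p) <ᵇ a p then 1 else 0)

-- r_p : index (from 1) of the run containing (0-based) position p.
runIndex : ∀ {n} → Permutation′ n → ℕ → ℕ
runIndex π p = suc (dcount (oneLine π) p)

runs : ∀ {n} → Permutation′ n → ℕ
runs {n} π = suc (dcount (oneLine π) (n ∸ 1))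

word : ∀ {n} → Permutation′ n → Vec ℕ n
word π = tabulate (λ v → runIndex π (toℕ (π ⟨$⟩ˡ v)))

-- The flip T on sequences a_0 ... a_(n-1): reverse every fall in place.
-- fallStart a i : first position of the fall containing i.
fallStart : (ℕ → ℕ) → ℕ → ℕ
fallStart a zero    = zero
fallStart a (suc i) = if a (suc i) <ᵇ a i then fallStart a i else suc i

fallEndGo : ℕ → (ℕ → ℕ) → ℕ → ℕ → ℕ
fallEndGo n a zero     i = i
fallEndGo n a (suc f) i =
  if (suc i <ᵇ n) ∧ (a (suc i) <ᵇ a i) then fallEndGo n a f (suc i) else i

fallEnd : ℕ → (ℕ → ℕ) → ℕ → ℕ
fallEnd n a i = fallEndGo n a (n ∸ i) i

flipT : ℕ → (ℕ → ℕ) → ℕ → ℕ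
flipT n a i = a ((fallStart a i + fallEnd n a i) ∸ i)

PopStacked : ∀ {n} → Permutation′ n → Set
PopStacked {n} π =
  ∃ λ (σ : Permutation′ n) → ∀ i → i < n → oneLine π i ≡ flipT n (oneLine σ) i

IsWord : ∀ {n} → ℕ → Vec ℕ n → Set
IsWord k u = ∀ p → 1 ≤ lookup u p × lookup u p ≤ k

Precedes : ∀ {n} → Vec ℕ n → ℕ → ℕ → Set
Precedes {n} u x y =
  Σ (Fin n) λ p → Σ (Fin n) λ q → toℕ p < toℕ q × lookup u p ≡ x × lookup u q ≡ y

Cond2 : ∀ {n} → ℕ → Vec ℕ n → Set
Cond2 k u = ∀ j → 1 ≤ j → suc j ≤ k → Precedes u (suc j) j

Cond3 : ∀ {n} → ℕ → Vec ℕ n → Set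
Cond3 k u = ∀ j → 1 ≤ j → suc j ≤ k → Precedes u (suc j) j × Precedes u j (suc j)

module Submission where

-- Proposition 4. Write u v for the letter of the value v in w(π), i.e. the
-- run index of the position of v (values and positions are 0-based here).
-- The one-line notation of π lists {0,…,n-1} in increasing order of the key
-- (letter, value): runs increase and later runs carry larger letters. A strict
-- total order has only one sorted enumeration, so π is determined by its word
-- (part 1). The descent between runs c+1 and c+2 puts a value of letter c+2
-- before a value of letter c+1 in w(π) (part 2). Conversely, sorting by the
-- key builds a permutation from any word; under Cond2 every letter change is a
-- descent and every repeated letter an ascent, so its run indices are the
-- letters and its word is the given one (part 3). For pop-stacked permutations
-- compare with the enumeration b sorted by (letter, decreasing value): under
-- Cond3 the falls of b are its blocks of equal letters, so the flip T(b) is the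
-- enumeration above (part 5); and if π = T(σ), each descent of π separates two
-- falls of σ, which yields an occurrence of j before one of j+1 (part 4).

open import Defs
open import Data.Nat using (ℕ; zero; suc; _+_; _∸_; _<_; _≤_; _>_; _<ᵇ_; _<?_; _≤?_; _≟_; z≤n; s≤s)
open import Data.Nat.Properties
open import Data.Nat.Induction using (<-rec)
open import Data.Bool using (true; false; T)
open import Data.Unit using (⊤; tt)
open import Data.Empty using (⊥; ⊥-elim)
open import Data.Fin using (Fin; toℕ; fromℕ<; punchOut)
open import Data.Fin.Properties using (toℕ-injective; toℕ<n; fromℕ<-toℕ; toℕ-fromℕ<; punchOut-injective; any?; injective⇒≤) renaming (_≟_ to _≟ᶠ_)
open import Data.Vec using (Vec; lookup)
open import Data.Vec.Properties using (lookup∘tabulate; tabulate-cong; tabulate∘lookup)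
open import Data.Fin.Permutation using (Permutation′; _⟨$⟩ʳ_; _⟨$⟩ˡ_; permutation; inverseˡ; inverseʳ)
open import Data.Product using (∃; _×_; _,_; proj₁; proj₂)
open import Data.Sum using (_⊎_; inj₁; inj₂)
open import Function.Definitions using (Injective)
open import Level using (0ℓ)
open import Relation.Nullary using (yes; no; ¬_)
open import Relation.Unary using (Decidable)
open import Relation.Binary.Core using (Rel)
open import Relation.Binary.Structures using (IsStrictTotalOrder)
open import Relation.Binary.Structures.Biased using (isStrictTotalOrderᶜ)
import Relation.Binary.Construct.Flip.EqAndOrd as Flip
open import Relation.Binary.Definitions using (Trichotomous; tri<; tri≈; tri>)
open import Relation.Binary.PropositionalEquality using (_≡_; _≢_; refl; sym; trans; cong; cong₂; subst; subst₂; isEquivalence; module ≡-Reasoning)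

<ᵇ-cases : ∀ x y → ((x <ᵇ y) ≡ true × x < y) ⊎ ((x <ᵇ y) ≡ false × y ≤ x)
<ᵇ-cases x y with x <ᵇ y in e
... | true  = inj₁ (refl , <ᵇ⇒< x y (subst T (sym e) tt))
... | false = inj₂ (refl , ≮⇒≥ (λ x<y → subst T e (<⇒<ᵇ x<y)))

MapsInto : (ℕ → ℕ) → ℕ → Set
MapsInto a n = ∀ p → p < n → a p < n

Onto : (ℕ → ℕ) → ℕ → Set
Onto a n = ∀ v → v < n → ∃ λ p → p < n × a p ≡ v

Sorted : Rel ℕ 0ℓ → (ℕ → ℕ) → ℕ → Set
Sorted R a n = ∀ p q → p < q → q < n → R (a p) (a q)

module SortedEnumeration {R : Rel ℕ 0ℓ} (R-sto : IsStrictTotalOrder _≡_ R) {n : ℕ} where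
  open IsStrictTotalOrder R-sto using (irrefl; asym)

  no-value-between : ∀ {a} → Sorted R a n → Onto a n → ∀ {p z} → suc p < n → z < n →
                     R (a p) z → R z (a (suc p)) → ⊥
  no-value-between {a} sorted onto {p} sp<n z<n ap<z z<asp with onto _ z<n
  ... | q , q<n , refl with <-cmp q p
  ... | tri< q<p _ _ = asym ap<z (sorted q p q<p (<-trans (n<1+n p) sp<n))
  ... | tri≈ _ refl _ = irrefl refl ap<z
  ... | tri> _ _ p<q with m≤n⇒m<n∨m≡n p<q
  ... | inj₁ sp<q = asym z<asp (sorted (suc p) q sp<q q<n)
  ... | inj₂ refl = irrefl refl z<asp

  sorted-enumeration-unique : ∀ {a g} →
    Sorted R a n → MapsInto a n → Onto a n →
    Sorted R g n → MapsInto g n → Onto g n → ∀ i → i < n → a i ≡ g i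
  sorted-enumeration-unique {a} {g} sa ia oa sg ig og = <-rec _ agree
    where
    -- strong induction on i: let g q = a i. If q < i, a i repeats the entry
    -- a q = g q; if q > i, the position q′ of g i in a must be i, since q′ < i
    -- repeats an entry and q′ > i orders a i and g i both ways.
    agree : ∀ i → (∀ {j} → j < i → j < n → a j ≡ g j) → i < n → a i ≡ g i
    agree i IH i<n with og (a i) (ia i i<n)
    ... | q , q<n , gq≡ai with <-cmp q i
    ... | tri< q<i _ _ = ⊥-elim (irrefl (trans (IH q<i q<n) gq≡ai) (sa q i q<i i<n))
    ... | tri≈ _ refl _ = sym gq≡ai
    ... | tri> _ _ i<q with oa (g i) (ig i i<n)
    ... | q′ , q′<n , aq′≡gi with <-cmp q′ i
    ... | tri< q′<i _ _ = ⊥-elim (irrefl (trans (sym (IH q′<i q′<n)) aq′≡gi) (sg q′ i q′<i i<n))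
    ... | tri≈ _ refl _ = aq′≡gi
    ... | tri> _ _ i<q′ = ⊥-elim (asym (subst (R (a i)) aq′≡gi (sa i q′ i<q′ q′<n))
                                       (subst (R (g i)) gq≡ai (sg i q i<q q<n)))

countBelow : {P : ℕ → Set} → Decidable P → ℕ → ℕ
countBelow P? zero = zero
countBelow P? (suc m) with P? m
... | yes _ = suc (countBelow P? m)
... | no _  = countBelow P? m

countBelow-all : ∀ m → countBelow {λ _ → ⊤} (λ _ → yes tt) m ≡ m
countBelow-all zero    = refl
countBelow-all (suc m) = cong suc (countBelow-all m)

module _ {P Q : ℕ → Set} (P? : Decidable P) (Q? : Decidable Q) where

  private
    restrict : ∀ {m} → (∀ x → x < suc m → P x → Q x) → ∀ x → x < m → P x → Q x
    restrict P⊆Q x x<m = P⊆Q x (m<n⇒m<1+n x<m)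

  countBelow-mono : ∀ m → (∀ x → x < m → P x → Q x) → countBelow P? m ≤ countBelow Q? m
  countBelow-mono zero    P⊆Q = z≤n
  countBelow-mono (suc m) P⊆Q with P? m | Q? m
  ... | yes _ | yes _  = s≤s (countBelow-mono m (restrict P⊆Q))
  ... | yes p | no ¬q  = ⊥-elim (¬q (P⊆Q m (n<1+n m) p))
  ... | no _  | yes _  = m≤n⇒m≤1+n (countBelow-mono m (restrict P⊆Q))
  ... | no _  | no _   = countBelow-mono m (restrict P⊆Q)

  countBelow-strict : ∀ m → (∀ x → x < m → P x → Q x) →
    ∀ {x₀} → x₀ < m → Q x₀ → ¬ P x₀ → countBelow P? m < countBelow Q? m
  countBelow-strict (suc m) P⊆Q {x₀} x₀<sm q ¬p with P? m | Q? m | x₀ ≟ m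
  ... | yes p | _     | yes refl = ⊥-elim (¬p p)
  ... | no _  | no ¬q | yes refl = ⊥-elim (¬q q)
  ... | no _  | yes _ | yes refl = s≤s (countBelow-mono m (restrict P⊆Q))
  ... | yes p | no ¬q | _        = ⊥-elim (¬q (P⊆Q m (n<1+n m) p))
  ... | yes _ | yes _ | no x₀≢m  =
    s≤s (countBelow-strict m (restrict P⊆Q) (≤∧≢⇒< (≤-pred x₀<sm) x₀≢m) q ¬p)
  ... | no _  | yes _ | no x₀≢m  =
    m<n⇒m<1+n (countBelow-strict m (restrict P⊆Q) (≤∧≢⇒< (≤-pred x₀<sm) x₀≢m) q ¬p)
  ... | no _  | no _  | no x₀≢m  =
    countBelow-strict m (restrict P⊆Q) (≤∧≢⇒< (≤-pred x₀<sm) x₀≢m) q ¬p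

countBelow-< : ∀ {P : ℕ → Set} (P? : Decidable P) m {x₀} → x₀ < m → ¬ P x₀ → countBelow P? m < m
countBelow-< P? m x₀<m ¬p = subst (countBelow P? m <_) (countBelow-all m)
  (countBelow-strict P? (λ _ → yes tt) m (λ _ _ _ → tt) x₀<m tt ¬p)

injective⇒surjective : ∀ {m} (f : Fin m → Fin m) → Injective _≡_ _≡_ f → ∀ y → ∃ λ x → f x ≡ y
injective⇒surjective {suc m} f f-inj y with any? (λ x → f x ≟ᶠ y)
... | yes hit = hit
... | no miss = ⊥-elim (1+n≰n (injective⇒≤ {f = squeeze} squeeze-inj))
  where
  -- if y is missed, f squeezes Fin (suc m) injectively into Fin m
  squeeze : Fin (suc m) → Fin m
  squeeze x = punchOut {i = y} {j = f x} (λ y≡fx → miss (x , sym y≡fx))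
  squeeze-inj : Injective _≡_ _≡_ squeeze
  squeeze-inj {i} {j} e =
    f-inj (punchOut-injective (λ e′ → miss (i , sym e′)) (λ e′ → miss (j , sym e′)) e)

module OneLine {n : ℕ} (π : Permutation′ n) where

  oneLine-fromℕ< : ∀ {p} (p<n : p < n) → oneLine π p ≡ toℕ (π ⟨$⟩ʳ fromℕ< p<n)
  oneLine-fromℕ< {p} p<n with p <? n
  ... | yes _  = refl
  ... | no p≮n = ⊥-elim (p≮n p<n)

  oneLine-toℕ : ∀ i → oneLine π (toℕ i) ≡ toℕ (π ⟨$⟩ʳ i)
  oneLine-toℕ i = trans (oneLine-fromℕ< (toℕ<n i)) (cong (λ j → toℕ (π ⟨$⟩ʳ j)) (fromℕ<-toℕ i _))

  oneLine-mapsInto : MapsInto (oneLine π) n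
  oneLine-mapsInto p p<n rewrite oneLine-fromℕ< p<n = toℕ<n _

  oneLine-onto : Onto (oneLine π) n
  oneLine-onto v v<n = toℕ (π ⟨$⟩ˡ fromℕ< v<n) , toℕ<n _ ,
    trans (oneLine-toℕ _) (trans (cong toℕ (inverseʳ π)) (toℕ-fromℕ< v<n))

  oneLine-injective : ∀ {p q} → p < n → q < n → oneLine π p ≡ oneLine π q → p ≡ q
  oneLine-injective {p} {q} p<n q<n e = begin
    p                                         ≡⟨ toℕ-fromℕ< p<n ⟨
    toℕ (fromℕ< p<n)                          ≡⟨ cong toℕ (inverseˡ π) ⟨
    toℕ (π ⟨$⟩ˡ (π ⟨$⟩ʳ fromℕ< p<n))          ≡⟨ cong (λ j → toℕ (π ⟨$⟩ˡ j)) same-image ⟩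
    toℕ (π ⟨$⟩ˡ (π ⟨$⟩ʳ fromℕ< q<n))          ≡⟨ cong toℕ (inverseˡ π) ⟩
    toℕ (fromℕ< q<n)                          ≡⟨ toℕ-fromℕ< q<n ⟩
    q                                         ∎
    where
    open ≡-Reasoning
    same-image : π ⟨$⟩ʳ fromℕ< p<n ≡ π ⟨$⟩ʳ fromℕ< q<n
    same-image = toℕ-injective (trans (sym (oneLine-fromℕ< p<n)) (trans e (oneLine-fromℕ< q<n)))

-- For a strict total order R on ℕ there is a permutation of size n whose
-- one-line notation is R-sorted: position p holds the value of R-rank p.
module SortingPermutation {R : Rel ℕ 0ℓ} (R-sto : IsStrictTotalOrder _≡_ R) (n : ℕ) where
  open IsStrictTotalOrder R-sto using (irrefl; compare) renaming (trans to R-trans; _<?_ to _R?_)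

  rank : ℕ → ℕ
  rank v = countBelow (_R? v) n

  -- v itself is not counted, so ranks stay below n; ranks grow along R.
  rank-< : ∀ {v} → v < n → rank v < n
  rank-< v<n = countBelow-< (_R? _) n v<n (irrefl refl)

  rank-mono : ∀ {v v′} → v < n → R v v′ → rank v < rank v′
  rank-mono v<n v<v′ = countBelow-strict (_R? _) (_R? _) n (λ _ _ x<v → R-trans x<v v<v′) v<n v<v′ (irrefl refl)

  rank-injective : ∀ {v w} → v < n → w < n → rank v ≡ rank w → v ≡ w
  rank-injective {v} {w} v<n w<n e with compare v w
  ... | tri< v<w _ _ = ⊥-elim (<-irrefl e (rank-mono v<n v<w))
  ... | tri≈ _ v≡w _ = v≡w
  ... | tri> _ _ w<v = ⊥-elim (<-irrefl (sym e) (rank-mono w<n w<v))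

  -- v ↦ rank v, as a map of Fin n; it is the inverse of the sorting permutation
  positionOf : Fin n → Fin n
  positionOf v = fromℕ< (rank-< (toℕ<n v))

  positionOf-rank : ∀ v → toℕ (positionOf v) ≡ rank (toℕ v)
  positionOf-rank v = toℕ-fromℕ< _

  positionOf-injective : Injective _≡_ _≡_ positionOf
  positionOf-injective {v} {w} e = toℕ-injective (rank-injective (toℕ<n v) (toℕ<n w)
    (trans (sym (positionOf-rank v)) (trans (cong toℕ e) (positionOf-rank w))))

  ranked⇒sorted : ∀ {a} → MapsInto a n → (∀ {p} → p < n → rank (a p) ≡ p) → Sorted R a n
  ranked⇒sorted {a} a-into a-ranked p q p<q q<n with compare (a p) (a q)
  ... | tri< ap<aq _ _ = ap<aq
  ... | tri≈ _ ap≡aq _ = ⊥-elim (<-irrefl same-position p<q)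
    where
    same-position : p ≡ q
    same-position = trans (sym (a-ranked (<-trans p<q q<n))) (trans (cong rank ap≡aq) (a-ranked q<n))
  ... | tri> _ _ aq<ap = ⊥-elim (<-asym p<q
        (subst₂ _<_ (a-ranked q<n) (a-ranked (<-trans p<q q<n)) (rank-mono (a-into q q<n) aq<ap)))

  private
    positionOf-surjective : ∀ p → ∃ λ v → positionOf v ≡ p
    positionOf-surjective = injective⇒surjective positionOf positionOf-injective

  sortingPermutation : Permutation′ n
  sortingPermutation = permutation (λ p → proj₁ (positionOf-surjective p)) positionOf
    (λ v → positionOf-injective (proj₂ (positionOf-surjective (positionOf v))))
    (λ p → proj₂ (positionOf-surjective p))

  rank-oneLine : ∀ {p} → p < n → rank (oneLine sortingPermutation p) ≡ p
  rank-oneLine {p} p<n = trans (cong rank (OneLine.oneLine-fromℕ< sortingPermutation p<n))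
    (trans (sym (positionOf-rank _)) (trans (cong toℕ (inverseˡ sortingPermutation)) (toℕ-fromℕ< p<n)))

  sortingPermutation-sorted : Sorted R (oneLine sortingPermutation) n
  sortingPermutation-sorted = ranked⇒sorted (OneLine.oneLine-mapsInto sortingPermutation) rank-oneLine

Key : Rel ℕ 0ℓ → (ℕ → ℕ) → Rel ℕ 0ℓ
Key T u x y = u x < u y ⊎ (u x ≡ u y × T x y)

key-letter-≤ : ∀ {T u x y} → Key T u x y → u x ≤ u y
key-letter-≤ (inj₁ ux<uy)      = <⇒≤ ux<uy
key-letter-≤ (inj₂ (ux≡uy , _)) = ≤-reflexive ux≡uy

module _ {T : Rel ℕ 0ℓ} (T-sto : IsStrictTotalOrder _≡_ T) (u : ℕ → ℕ) where
  private module T = IsStrictTotalOrder T-sto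

  key-trans : ∀ {x y z} → Key T u x y → Key T u y z → Key T u x z
  key-trans (inj₁ ux<uy)        (inj₁ uy<uz)        = inj₁ (<-trans ux<uy uy<uz)
  key-trans {x} (inj₁ ux<uy)   (inj₂ (uy≡uz , _))  = inj₁ (subst (u x <_) uy≡uz ux<uy)
  key-trans {z = z} (inj₂ (ux≡uy , _)) (inj₁ uy<uz) = inj₁ (subst (_< u z) (sym ux≡uy) uy<uz)
  key-trans (inj₂ (ux≡uy , Txy)) (inj₂ (uy≡uz , Tyz)) = inj₂ (trans ux≡uy uy≡uz , T.trans Txy Tyz)

  key-isStrictTotalOrder : IsStrictTotalOrder _≡_ (Key T u)
  key-isStrictTotalOrder = isStrictTotalOrderᶜ record
    { isEquivalence = isEquivalence
    ; trans         = key-trans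
    ; compare       = key-compare
    }
    where
    key-compare : Trichotomous _≡_ (Key T u)
    key-compare x y with <-cmp (u x) (u y)
    ... | tri< ux<uy ux≢uy ux≯uy = tri< (inj₁ ux<uy) (λ x≡y → ux≢uy (cong u x≡y))
          λ { (inj₁ uy<ux) → ux≯uy uy<ux ; (inj₂ (uy≡ux , _)) → ux≢uy (sym uy≡ux) }
    ... | tri> ux≮uy ux≢uy uy<ux = tri> (λ { (inj₁ ux<uy) → ux≮uy ux<uy ; (inj₂ (ux≡uy , _)) → ux≢uy ux≡uy })
          (λ x≡y → ux≢uy (cong u x≡y)) (inj₁ uy<ux)
    ... | tri≈ ux≮uy ux≡uy ux≯uy with T.compare x y
    ...   | tri< Txy x≢y ¬Tyx = tri< (inj₂ (ux≡uy , Txy)) x≢y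
            λ { (inj₁ uy<ux) → ux≯uy uy<ux ; (inj₂ (_ , Tyx)) → ¬Tyx Tyx }
    ...   | tri≈ ¬Txy x≡y ¬Tyx = tri≈ (λ { (inj₁ ux<uy) → ux≮uy ux<uy ; (inj₂ (_ , Txy)) → ¬Txy Txy }) x≡y
            λ { (inj₁ uy<ux) → ux≯uy uy<ux ; (inj₂ (_ , Tyx)) → ¬Tyx Tyx }
    ...   | tri> ¬Txy x≢y Tyx = tri> (λ { (inj₁ ux<uy) → ux≮uy ux<uy ; (inj₂ (_ , Txy)) → ¬Txy Txy }) x≢y
            (inj₂ (sym ux≡uy , Tyx))

module Descents (a : ℕ → ℕ) where

  dcount-suc : ∀ p → (a (suc p) < a p × dcount a (suc p) ≡ suc (dcount a p))
                   ⊎ (a p ≤ a (suc p) × dcount a (suc p) ≡ dcount a p)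
  dcount-suc p with <ᵇ-cases (a (suc p)) (a p)
  ... | inj₁ (e , desc) rewrite e = inj₁ (desc , +-comm (dcount a p) 1)
  ... | inj₂ (e , asc)  rewrite e = inj₂ (asc , +-identityʳ (dcount a p))

  dcount-mono : ∀ {p q} → p ≤ q → dcount a p ≤ dcount a q
  dcount-mono {q = zero} z≤n = ≤-refl
  dcount-mono {p} {suc q} p≤sq with m≤n⇒m<n∨m≡n p≤sq
  ... | inj₂ refl = ≤-refl
  ... | inj₁ p<sq with dcount-suc q
  ...   | inj₁ (_ , e) = ≤-trans (dcount-mono (≤-pred p<sq)) (subst (dcount a q ≤_) (sym e) (n≤1+n _))
  ...   | inj₂ (_ , e) = ≤-trans (dcount-mono (≤-pred p<sq)) (≤-reflexive (sym e))

  dcount-constant : ∀ {p q} → p ≤ q → (∀ m → p ≤ m → m < q → a m ≤ a (suc m)) → dcount a p ≡ dcount a q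
  dcount-constant {q = zero} z≤n _ = refl
  dcount-constant {p} {suc q} p≤sq asc with m≤n⇒m<n∨m≡n p≤sq
  ... | inj₂ refl = refl
  ... | inj₁ p<sq with dcount-suc q
  ...   | inj₁ (desc , _) = ⊥-elim (<⇒≱ desc (asc q (≤-pred p<sq) (n<1+n q)))
  ...   | inj₂ (_ , e)    =
    trans (dcount-constant (≤-pred p<sq) (λ m p≤m m<q → asc m p≤m (m<n⇒m<1+n m<q))) (sym e)

  -- Every level c below dcount a m is left by a descent t < m
  -- (this descent t separates the runs c+1 and c+2).
  descent-at-level : ∀ m c → c < dcount a m →
    ∃ λ t → t < m × dcount a t ≡ c × a (suc t) < a t × dcount a (suc t) ≡ suc c
  descent-at-level (suc m) c c<count with c <? dcount a m
  ... | yes c<count′ with descent-at-level m c c<count′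
  ...   | t , t<m , rest = t , m<n⇒m<1+n t<m , rest
  descent-at-level (suc m) c c<count | no c≮count′ with dcount-suc m
  ... | inj₂ (_ , e)    = ⊥-elim (c≮count′ (subst (c <_) e c<count))
  ... | inj₁ (desc , e) = m , n<1+n m , count≡c , desc , trans e (cong suc count≡c)
    where
    count≡c : dcount a m ≡ c
    count≡c = ≤-antisym (≮⇒≥ c≮count′) (≤-pred (subst (c <_) e c<count))

  same-run⇒< : ∀ {p q} → p < q → dcount a p ≡ dcount a q →
               (∀ m → m < q → a m ≢ a (suc m)) → a p < a q
  same-run⇒< {p} {suc q} p<sq same distinct with m≤n⇒m<n∨m≡n (≤-pred p<sq) | dcount-suc q
  ... | _          | inj₁ (_ , e) = ⊥-elim (<-irrefl refl
        (≤-trans (s≤s (dcount-mono (≤-pred p<sq))) (≤-reflexive (trans (sym e) (sym same)))))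
  ... | inj₂ refl  | inj₂ (asc , _) = ≤∧≢⇒< asc (distinct p (n<1+n p))
  ... | inj₁ p<q   | inj₂ (asc , e) = <-≤-trans
        (same-run⇒< p<q (≤-antisym (dcount-mono (<⇒≤ p<q)) (≤-reflexive (trans (sym e) (sym same))))
                    (λ m m<q → distinct m (m<n⇒m<1+n m<q)))
        asc

-- Fuel bookkeeping for fallEnd: one step from i to i+1 uses one unit.
n∸i≡suc : ∀ {n i} → i < n → n ∸ i ≡ suc (n ∸ suc i)
n∸i≡suc {suc n} {zero}  _         = refl
n∸i≡suc {suc n} {suc i} (s≤s i<n) = n∸i≡suc i<n

descents⇒decreasing : ∀ {b : ℕ → ℕ} {s e} → (∀ m → s ≤ m → m < e → b (suc m) < b m) →
                      ∀ {p q} → s ≤ p → p < q → q ≤ e → b q < b p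
descents⇒decreasing desc {p} {suc q} s≤p p<sq sq≤e with m≤n⇒m<n∨m≡n (≤-pred p<sq)
... | inj₂ refl = desc p s≤p sq≤e
... | inj₁ p<q  = <-trans (desc q (≤-trans s≤p (<⇒≤ p<q)) sq≤e)
                          (descents⇒decreasing desc s≤p p<q (≤-trans (n≤1+n q) sq≤e))

module Falls (n : ℕ) (b : ℕ → ℕ) where

  Descent : ℕ → Set
  Descent m = b (suc m) < b m

  start : ℕ → ℕ
  start = fallStart b

  end : ℕ → ℕ
  end = fallEnd n b

  start-descent : ∀ i → Descent i → start (suc i) ≡ start i
  start-descent i desc with <ᵇ-cases (b (suc i)) (b i)
  ... | inj₁ (e , _)   rewrite e = refl
  ... | inj₂ (_ , asc) = ⊥-elim (<⇒≱ desc asc)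

  start-ascent : ∀ i → ¬ Descent i → start (suc i) ≡ suc i
  start-ascent i ¬desc with <ᵇ-cases (b (suc i)) (b i)
  ... | inj₁ (_ , desc) = ⊥-elim (¬desc desc)
  ... | inj₂ (e , _)    rewrite e = refl

  start-≤ : ∀ i → start i ≤ i
  start-≤ zero    = z≤n
  start-≤ (suc i) with <ᵇ-cases (b (suc i)) (b i)
  ... | inj₁ (e , _) rewrite e = m≤n⇒m≤1+n (start-≤ i)
  ... | inj₂ (e , _) rewrite e = ≤-refl

  start-descents : ∀ i m → start i ≤ m → m < i → Descent m
  start-descents (suc i) m start≤m m<si with <ᵇ-cases (b (suc i)) (b i)
  ... | inj₂ (e , _) rewrite e = ⊥-elim (<⇒≱ m<si start≤m)
  ... | inj₁ (e , desc) rewrite e with m≤n⇒m<n∨m≡n (≤-pred m<si)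
  ...   | inj₂ refl = desc
  ...   | inj₁ m<i  = start-descents i m start≤m m<i

  start-constant : ∀ s j → s ≤ j → (∀ m → s ≤ m → m < j → Descent m) → start j ≡ start s
  start-constant s zero    z≤n _ = refl
  start-constant s (suc j) s≤sj desc with m≤n⇒m<n∨m≡n s≤sj
  ... | inj₂ refl = refl
  ... | inj₁ s<sj = trans (start-descent j (desc j (≤-pred s<sj) (n<1+n j)))
                          (start-constant s j (≤-pred s<sj) (λ m s≤m m<j → desc m s≤m (m<n⇒m<1+n m<j)))

  FallEnd : ℕ → ℕ → Set
  FallEnd i e = i ≤ e × e < n × (∀ m → i ≤ m → m < e → Descent m) × (suc e < n → ¬ Descent e)

  fallEndGo-spec : ∀ f i → f + i ≡ n → i < n → FallEnd i (fallEndGo n b f i)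
  fallEndGo-spec zero    i f+i≡n i<n = ⊥-elim (<-irrefl f+i≡n i<n)
  fallEndGo-spec (suc f) i f+i≡n i<n with <ᵇ-cases (suc i) n | <ᵇ-cases (b (suc i)) (b i)
  ... | inj₁ (e₁ , si<n) | inj₁ (e₂ , desc) rewrite e₁ | e₂
        with fallEndGo-spec f (suc i) (trans (+-suc f i) f+i≡n) si<n
  ...   | i<e , e<n , descs , stop = <⇒≤ i<e , e<n , descs′ , stop
    where
    descs′ : ∀ m → i ≤ m → m < fallEndGo n b f (suc i) → Descent m
    descs′ m i≤m m<e with m≤n⇒m<n∨m≡n i≤m
    ... | inj₂ refl = desc
    ... | inj₁ i<m  = descs m i<m m<e
  fallEndGo-spec (suc f) i f+i≡n i<n | inj₁ (e₁ , _) | inj₂ (e₂ , asc) rewrite e₁ | e₂ =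
    ≤-refl , i<n , (λ m i≤m m<i → ⊥-elim (<⇒≱ m<i i≤m)) , (λ _ desc → <⇒≱ desc asc)
  fallEndGo-spec (suc f) i f+i≡n i<n | inj₂ (e₁ , n≤si) | _ rewrite e₁ =
    ≤-refl , i<n , (λ m i≤m m<i → ⊥-elim (<⇒≱ m<i i≤m)) , (λ si<n _ → <⇒≱ si<n n≤si)

  end-spec : ∀ {i} → i < n → FallEnd i (end i)
  end-spec {i} i<n = fallEndGo-spec (n ∸ i) i (m∸n+n≡m (<⇒≤ i<n)) i<n

  end-≥ : ∀ {i} → i < n → i ≤ end i
  end-≥ i<n = proj₁ (end-spec i<n)

  end-< : ∀ {i} → i < n → end i < n
  end-< i<n = proj₁ (proj₂ (end-spec i<n))

  end-descents : ∀ {i} → i < n → ∀ m → i ≤ m → m < end i → Descent m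
  end-descents i<n = proj₁ (proj₂ (proj₂ (end-spec i<n)))

  end-ascent : ∀ {i} → i < n → suc (end i) < n → ¬ Descent (end i)
  end-ascent i<n = proj₂ (proj₂ (proj₂ (end-spec i<n)))

  end-descent : ∀ i → suc i < n → Descent i → end i ≡ end (suc i)
  end-descent i si<n desc rewrite n∸i≡suc (<-trans (n<1+n i) si<n)
    with <ᵇ-cases (suc i) n | <ᵇ-cases (b (suc i)) (b i)
  ... | inj₁ (e₁ , _) | inj₁ (e₂ , _) rewrite e₁ | e₂ = refl
  ... | inj₂ (_ , n≤si) | _ = ⊥-elim (<⇒≱ si<n n≤si)
  ... | _ | inj₂ (_ , asc) = ⊥-elim (<⇒≱ desc asc)

  end-constant : ∀ i j → i ≤ j → j < n → (∀ m → i ≤ m → m < j → Descent m) → end i ≡ end j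
  end-constant i zero    z≤n _ _ = refl
  end-constant i (suc j) i≤sj sj<n desc with m≤n⇒m<n∨m≡n i≤sj
  ... | inj₂ refl = refl
  ... | inj₁ i<sj = trans (end-constant i j (≤-pred i<sj) (<-trans (n<1+n j) sj<n)
                                        (λ m i≤m m<j → desc m i≤m (m<n⇒m<1+n m<j)))
                          (end-descent j sj<n (desc j (≤-pred i<sj) (n<1+n j)))

  fall-descents : ∀ {i} → i < n → ∀ m → start i ≤ m → m < end i → Descent m
  fall-descents {i} i<n m start≤m m<end with m <? i
  ... | yes m<i = start-descents i m start≤m m<i
  ... | no m≮i  = end-descents i<n m (≮⇒≥ m≮i) m<end

  same-fall : ∀ {i} → i < n → ∀ j → start i ≤ j → j ≤ end i → start j ≡ start i × end j ≡ end i
  same-fall {i} i<n j start≤j j≤end = trans start-j (sym start-i) , end-j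
    where
    start-j : start j ≡ start (start i)
    start-j = start-constant (start i) j start≤j (λ m s≤m m<j → fall-descents i<n m s≤m (<-≤-trans m<j j≤end))
    start-i : start i ≡ start (start i)
    start-i = start-constant (start i) i (start-≤ i) (start-descents i)
    end-j : end j ≡ end i
    end-j with j ≤? i
    ... | yes j≤i = end-constant j i j≤i i<n
                      (λ m j≤m m<i → fall-descents i<n m (≤-trans start≤j j≤m) (<-≤-trans m<i (end-≥ i<n)))
    ... | no j≰i  = sym (end-constant i j (<⇒≤ (≰⇒> j≰i)) (≤-<-trans j≤end (end-< i<n))
                      (λ m i≤m m<j → fall-descents i<n m (≤-trans (start-≤ i) i≤m) (<-≤-trans m<j j≤end)))

  mirror : ℕ → ℕ
  mirror i = start i + end i ∸ i

  mirror-≡ : ∀ {i} → i < n → mirror i ≡ start i + (end i ∸ i)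
  mirror-≡ {i} i<n = +-∸-assoc (start i) (end-≥ i<n)

  mirror-≥ : ∀ {i} → i < n → start i ≤ mirror i
  mirror-≥ {i} i<n = subst (start i ≤_) (sym (mirror-≡ i<n)) (m≤m+n _ _)

  mirror-≤ : ∀ {i} → i < n → mirror i ≤ end i
  mirror-≤ {i} i<n = subst (_≤ end i) (sym (mirror-≡ i<n))
    (≤-trans (+-monoˡ-≤ (end i ∸ i) (start-≤ i)) (≤-reflexive (m+[n∸m]≡n (end-≥ i<n))))

  mirror-< : ∀ {i} → i < n → mirror i < n
  mirror-< i<n = ≤-<-trans (mirror-≤ i<n) (end-< i<n)

  mirror-involutive : ∀ {i} → i < n → mirror (mirror i) ≡ i
  mirror-involutive {i} i<n with same-fall i<n (mirror i) (mirror-≥ i<n) (mirror-≤ i<n)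
  ... | start≡ , end≡ rewrite start≡ | end≡ = m∸[m∸n]≡n (≤-trans (end-≥ i<n) (m≤n+m (end i) (start i)))

  mirror-antitone : ∀ {i i′} → i < n → i < i′ → i′ ≤ end i → mirror i′ < mirror i
  mirror-antitone {i} {i′} i<n i<i′ i′≤end with same-fall i<n i′ (≤-trans (start-≤ i) (<⇒≤ i<i′)) i′≤end
  ... | start≡ , end≡ rewrite start≡ | end≡ = ∸-monoʳ-< i<i′ (≤-trans i′≤end (m≤n+m (end i) (start i)))

  mirror-in-fall : ∀ {i j} → i < n → start i ≤ j → j ≤ end i → start i ≤ mirror j × mirror j ≤ end i
  mirror-in-fall {i} {j} i<n start≤j j≤end with same-fall i<n j start≤j j≤end
  ... | start≡ , end≡ = subst (_≤ mirror j) start≡ (mirror-≥ j<n) , subst (mirror j ≤_) end≡ (mirror-≤ j<n)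
    where
    j<n : j < n
    j<n = ≤-<-trans j≤end (end-< i<n)

  mirror-decreasing : ∀ {i i′} → i < n → i < i′ → i′ ≤ end i → b (mirror i) < b (mirror i′)
  mirror-decreasing {i} i<n i<i′ i′≤end =
    descents⇒decreasing (fall-descents i<n)
      (proj₁ (mirror-in-fall i<n (≤-trans (start-≤ i) (<⇒≤ i<i′)) i′≤end))
      (mirror-antitone i<n i<i′ i′≤end) (mirror-≤ i<n)

LettersIn : ℕ → ℕ → (ℕ → ℕ) → Set
LettersIn n k u = ∀ v → v < n → 1 ≤ u v × u v ≤ k

Precedesℕ : ℕ → (ℕ → ℕ) → ℕ → ℕ → Set
Precedesℕ n u x y = ∃ λ p → ∃ λ q → p < q × q < n × u p ≡ x × u q ≡ y

DownSteps : ℕ → ℕ → (ℕ → ℕ) → Set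
DownSteps n k u = ∀ j → 1 ≤ j → suc j ≤ k → Precedesℕ n u (suc j) j

UpSteps : ℕ → ℕ → (ℕ → ℕ) → Set
UpSteps n k u = ∀ j → 1 ≤ j → suc j ≤ k → Precedesℕ n u j (suc j)

n∸1<n : ∀ {n} → 1 ≤ n → n ∸ 1 < n
n∸1<n (s≤s z≤n) = ≤-refl

module SortedByLetter {T : Rel ℕ 0ℓ} (T-sto : IsStrictTotalOrder _≡_ T)
  {n k : ℕ} (u a : ℕ → ℕ) (n≥1 : 1 ≤ n)
  (a-sorted : Sorted (Key T u) a n) (a-into : MapsInto a n) (a-onto : Onto a n)
  (u-letters : LettersIn n k u) (u-down : DownSteps n k u) where

  open SortedEnumeration (key-isStrictTotalOrder T-sto u) {n}

  letter-occurs : ∀ c → 1 ≤ c → c ≤ k → ∃ λ z → z < n × u z ≡ c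
  letter-occurs (suc zero) _ 1≤k with k ≟ 1
  ... | yes refl = 0 , n≥1 , ≤-antisym (proj₂ (u-letters 0 n≥1)) (proj₁ (u-letters 0 n≥1))
  ... | no k≢1 with u-down 1 ≤-refl (≤∧≢⇒< 1≤k (λ e → k≢1 (sym e)))
  ...   | _ , y , _ , y<n , _ , uy≡1 = y , y<n , uy≡1
  letter-occurs (suc (suc j)) _ sj<k with u-down (suc j) (s≤s z≤n) sj<k
  ... | x , _ , x<y , y<n , ux≡ssj , _ = x , <-trans x<y y<n , ux≡ssj

  letter-mono : ∀ {p q} → p ≤ q → q < n → u (a p) ≤ u (a q)
  letter-mono {p} p≤q q<n with m≤n⇒m<n∨m≡n p≤q
  ... | inj₂ refl = ≤-refl
  ... | inj₁ p<q  = key-letter-≤ {T} {u} (a-sorted p _ p<q q<n)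

  same-letter⇒tie-break : ∀ p → suc p < n → u (a (suc p)) ≡ u (a p) → T (a p) (a (suc p))
  same-letter⇒tie-break p sp<n same with a-sorted p (suc p) (n<1+n p) sp<n
  ... | inj₁ up<usp      = ⊥-elim (<-irrefl (sym same) up<usp)
  ... | inj₂ (_ , tied)  = tied

  below-letter-change : ∀ {p z} → suc p < n → u (a (suc p)) ≡ suc (u (a p)) →
                        z < n → u z ≡ u (a p) → ¬ T (a p) z
  below-letter-change sp<n change z<n uz≡ Tapz =
    no-value-between a-sorted a-onto sp<n z<n (inj₂ (sym uz≡ , Tapz))
      (inj₁ (subst₂ _<_ (sym uz≡) (sym change) ≤-refl))

  above-letter-change : ∀ {p z} → suc p < n → u (a (suc p)) ≡ suc (u (a p)) →
                        z < n → u z ≡ u (a (suc p)) → ¬ T z (a (suc p))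
  above-letter-change {p} sp<n change z<n uz≡ Tzasp =
    no-value-between a-sorted a-onto sp<n z<n
      (inj₁ (subst (u (a p) <_) (sym (trans uz≡ change)) ≤-refl)) (inj₂ (uz≡ , Tzasp))

  -- The letter grows by at most one from one position to the next,
  -- since DownSteps makes every letter between 1 and k occur.
  letter-next : ∀ p → suc p < n → u (a (suc p)) ≡ u (a p) ⊎ u (a (suc p)) ≡ suc (u (a p))
  letter-next p sp<n with m≤n⇒m<n∨m≡n (letter-mono (n≤1+n p) sp<n)
  ... | inj₂ same = inj₁ (sym same)
  ... | inj₁ up<usp with u (a (suc p)) ≤? suc (u (a p))
  ...   | yes usp≤ = inj₂ (≤-antisym usp≤ up<usp)
  ...   | no usp≰ with letter-occurs (suc (u (a p))) (s≤s z≤n)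
                         (≤-trans (<⇒≤ (≰⇒> usp≰)) (proj₂ (u-letters _ (a-into _ sp<n))))
  ...     | z , z<n , uz≡ = ⊥-elim (no-value-between a-sorted a-onto sp<n z<n
              (inj₁ (subst (u (a p) <_) (sym uz≡) ≤-refl))
              (inj₁ (subst (_< u (a (suc p))) (sym uz≡) (≰⇒> usp≰))))

  first-letter : u (a 0) ≡ 1
  first-letter with letter-occurs 1 ≤-refl (≤-trans (proj₁ (u-letters 0 n≥1)) (proj₂ (u-letters 0 n≥1)))
  ... | z , z<n , uz≡1 with a-onto z z<n
  ...   | q , q<n , refl = ≤-antisym (subst (u (a 0) ≤_) uz≡1 (letter-mono z≤n q<n))
                                     (proj₁ (u-letters _ (a-into 0 n≥1)))

  last-letter : 1 ≤ k → u (a (n ∸ 1)) ≡ k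
  last-letter k≥1 with letter-occurs k k≥1 ≤-refl
  ... | z , z<n , uz≡k with a-onto z z<n
  ...   | q , q<n , refl = ≤-antisym (proj₂ (u-letters _ (a-into _ (n∸1<n n≥1))))
                                     (subst (_≤ u (a (n ∸ 1))) uz≡k (letter-mono (<⇒≤pred q<n) (n∸1<n n≥1)))

-- With the increasing tie-break the letters along a are the run indices of a:
-- a letter change forces a descent, an unchanged letter an ascent.
module RunsOfSortedWord {n k : ℕ} (u a : ℕ → ℕ) (n≥1 : 1 ≤ n)
  (a-sorted : Sorted (Key _<_ u) a n) (a-into : MapsInto a n) (a-onto : Onto a n)
  (u-letters : LettersIn n k u) (u-down : DownSteps n k u) where

  open SortedByLetter <-isStrictTotalOrder u a n≥1 a-sorted a-into a-onto u-letters u-down public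
  open Descents a

  letter-change⇒descent : ∀ p → suc p < n → u (a (suc p)) ≡ suc (u (a p)) → a (suc p) < a p
  letter-change⇒descent p sp<n change
    with u-down (u (a p)) (proj₁ (u-letters _ (a-into p (<-trans (n<1+n p) sp<n))))
                (subst (_≤ k) change (proj₂ (u-letters _ (a-into _ sp<n))))
  ... | x , y , x<y , y<n , ux≡ , uy≡ =
    ≤-<-trans (≮⇒≥ (above-letter-change sp<n change (<-trans x<y y<n) (trans ux≡ (sym change))))
              (<-≤-trans x<y (≮⇒≥ (below-letter-change sp<n change y<n uy≡)))

  runIndex≡letter : ∀ p → p < n → suc (dcount a p) ≡ u (a p)
  runIndex≡letter zero    _    = sym first-letter
  runIndex≡letter (suc p) sp<n with letter-next p sp<n | dcount-suc p
  ... | inj₁ same   | inj₁ (desc , _) = ⊥-elim (<-asym desc (same-letter⇒tie-break p sp<n same))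
  ... | inj₁ same   | inj₂ (_ , e)    =
    trans (cong suc e) (trans (runIndex≡letter p (<-trans (n<1+n p) sp<n)) (sym same))
  ... | inj₂ change | inj₁ (_ , e)    =
    trans (cong suc e) (trans (cong suc (runIndex≡letter p (<-trans (n<1+n p) sp<n))) (sym change))
  ... | inj₂ change | inj₂ (asc , _)  = ⊥-elim (<⇒≱ (letter-change⇒descent p sp<n change) asc)

>-isStrictTotalOrder : IsStrictTotalOrder _≡_ _>_
>-isStrictTotalOrder = Flip.isStrictTotalOrder <-isStrictTotalOrder

-- Let a and b enumerate {0,…,n-1} sorted by letter, ties broken increasingly
-- in a and decreasingly in b, for a word u with both DownSteps and UpSteps.
-- Then a is the flip of b: the falls of b are exactly its blocks of equal
-- letters, and reversing them turns b into the increasing tie-break a.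
module FlipOfSortedWord {n k : ℕ} (u a b : ℕ → ℕ) (n≥1 : 1 ≤ n)
  (a-sorted : Sorted (Key _<_ u) a n) (a-into : MapsInto a n) (a-onto : Onto a n)
  (b-sorted : Sorted (Key _>_ u) b n) (b-into : MapsInto b n) (b-onto : Onto b n)
  (u-letters : LettersIn n k u) (u-down : DownSteps n k u) (u-up : UpSteps n k u) where

  private
    module B = SortedByLetter >-isStrictTotalOrder u b n≥1 b-sorted b-into b-onto u-letters u-down
  open Falls n b

  letter-change⇒ascent : ∀ p → suc p < n → u (b (suc p)) ≡ suc (u (b p)) → b p < b (suc p)
  letter-change⇒ascent p sp<n change
    with u-up (u (b p)) (proj₁ (u-letters _ (b-into p (<-trans (n<1+n p) sp<n))))
              (subst (_≤ k) change (proj₂ (u-letters _ (b-into _ sp<n))))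
  ... | x , y , x<y , y<n , ux≡ , uy≡ =
    ≤-<-trans (≮⇒≥ (B.below-letter-change sp<n change (<-trans x<y y<n) ux≡))
              (<-≤-trans x<y (≮⇒≥ (B.above-letter-change sp<n change y<n (trans uy≡ (sym change)))))

  descent⇒same-letter : ∀ p → suc p < n → Descent p → u (b (suc p)) ≡ u (b p)
  descent⇒same-letter p sp<n desc with B.letter-next p sp<n
  ... | inj₁ same   = same
  ... | inj₂ change = ⊥-elim (<-asym desc (letter-change⇒ascent p sp<n change))

  ascent⇒letter-up : ∀ p → suc p < n → ¬ Descent p → u (b p) < u (b (suc p))
  ascent⇒letter-up p sp<n ¬desc with b-sorted p (suc p) (n<1+n p) sp<n
  ... | inj₁ up<usp      = up<usp
  ... | inj₂ (_ , desc)  = ⊥-elim (¬desc desc)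

  descents⇒same-letter : ∀ p q → p ≤ q → q < n → (∀ m → p ≤ m → m < q → Descent m) → u (b q) ≡ u (b p)
  descents⇒same-letter p zero    z≤n _ _ = refl
  descents⇒same-letter p (suc q) p≤sq sq<n desc with m≤n⇒m<n∨m≡n p≤sq
  ... | inj₂ refl = refl
  ... | inj₁ p<sq = trans (descent⇒same-letter q sq<n (desc q (≤-pred p<sq) (n<1+n q)))
      (descents⇒same-letter p q (≤-pred p<sq) (<-trans (n<1+n q) sq<n) (λ m p≤m m<q → desc m p≤m (m<n⇒m<1+n m<q)))

  flip-sorted-in-fall : ∀ {i i′} → i < n → i < i′ → i′ ≤ end i → Key _<_ u (flipT n b i) (flipT n b i′)
  flip-sorted-in-fall {i} {i′} i<n i<i′ i′≤end = inj₂ (same-letter , mirror-decreasing i<n i<i′ i′≤end)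
    where
    start≤mirror-i′ : start i ≤ mirror i′
    start≤mirror-i′ = proj₁ (mirror-in-fall i<n (≤-trans (start-≤ i) (<⇒≤ i<i′)) i′≤end)
    same-letter : u (b (mirror i)) ≡ u (b (mirror i′))
    same-letter = descents⇒same-letter (mirror i′) (mirror i) (<⇒≤ (mirror-antitone i<n i<i′ i′≤end))
      (mirror-< i<n) (λ m p≤m m<q → fall-descents i<n m (≤-trans start≤mirror-i′ p≤m) (<-≤-trans m<q (mirror-≤ i<n)))

  -- Across falls: the ascent ending the fall of i raises the letter.
  flip-sorted-across-falls : ∀ {i i′} → i′ < n → end i < i′ → i < n → Key _<_ u (flipT n b i) (flipT n b i′)
  flip-sorted-across-falls {i} {i′} i′<n end<i′ i<n =
    inj₁ (subst (_< u (b (mirror i′))) letter-of-end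
           (<-≤-trans (ascent⇒letter-up (end i) send<n ends-with-ascent)
                      (B.letter-mono (≤-trans next-fall (mirror-≥ i′<n)) (mirror-< i′<n))))
    where
    send<n : suc (end i) < n
    send<n = ≤-<-trans end<i′ i′<n
    ends-with-ascent : ¬ Descent (end i)
    ends-with-ascent = end-ascent i<n send<n
    next-fall : suc (end i) ≤ start i′
    next-fall with start i′ ≤? end i
    ... | yes start≤end = ⊥-elim (ends-with-ascent (start-descents i′ (end i) start≤end end<i′))
    ... | no start≰end  = ≰⇒> start≰end
    letter-of-end : u (b (end i)) ≡ u (b (mirror i))
    letter-of-end = descents⇒same-letter (mirror i) (end i) (mirror-≤ i<n) (end-< i<n)
      (λ m p≤m m<q → fall-descents i<n m (≤-trans (mirror-≥ i<n) p≤m) m<q)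

  flip-sorted : Sorted (Key _<_ u) (flipT n b) n
  flip-sorted i i′ i<i′ i′<n with i′ ≤? end i
  ... | yes i′≤end = flip-sorted-in-fall (<-trans i<i′ i′<n) i<i′ i′≤end
  ... | no i′≰end  = flip-sorted-across-falls i′<n (≰⇒> i′≰end) (<-trans i<i′ i′<n)

  flip-onto : Onto (flipT n b) n
  flip-onto v v<n with b-onto v v<n
  ... | q , q<n , bq≡v = mirror q , mirror-< q<n , trans (cong b (mirror-involutive q<n)) bq≡v

  -- Both a and flipT n b are letter-sorted enumerations, so they coincide.
  a≡flip : ∀ i → i < n → a i ≡ flipT n b i
  a≡flip = SortedEnumeration.sorted-enumeration-unique (key-isStrictTotalOrder <-isStrictTotalOrder u)
    a-sorted a-into a-onto flip-sorted (λ i i<n → b-into _ (mirror-< i<n)) flip-onto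

-- Conversely, let a = T(b) on positions below n with b injective. Each fall
-- of b becomes an ascending stretch of a, so a descent t of a separates two
-- falls of b; the first entry of a's run through t (read from the first fall)
-- is then smaller than the last entry of a's run through t+1.
module RunsOfFlip (n : ℕ) (a b : ℕ → ℕ) (a≡flip : ∀ i → i < n → a i ≡ flipT n b i)
  (b-injective : ∀ {p q} → p < n → q < n → b p ≡ b q → p ≡ q) where
  open Falls n b
  open Descents a

  ascent-in-fall : ∀ m → m < n → suc m ≤ end m → a m < a (suc m)
  ascent-in-fall m m<n sm≤end =
    subst₂ _<_ (sym (a≡flip m m<n)) (sym (a≡flip (suc m) (≤-<-trans sm≤end (end-< m<n))))
      (mirror-decreasing m<n (n<1+n m) sm≤end)

  dcount-constant-on-fall : ∀ {i p q} → i < n → start i ≤ p → p ≤ q → q ≤ end i → dcount a p ≡ dcount a q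
  dcount-constant-on-fall {i} i<n start≤p p≤q q≤end = dcount-constant p≤q λ m p≤m m<q →
    <⇒≤ (ascent-in-fall m (<-trans m<q (≤-<-trans q≤end (end-< i<n)))
      (subst (suc m ≤_) (sym (proj₂ (same-fall i<n m (≤-trans start≤p p≤m) (<⇒≤ (<-≤-trans m<q q≤end)))))
        (<-≤-trans m<q q≤end)))

  module _ {t : ℕ} (st<n : suc t < n) (desc : a (suc t) < a t) where
    private
      t<n : t < n
      t<n = <-trans (n<1+n t) st<n

    fall-ends-at-descent : end t ≡ t
    fall-ends-at-descent with m≤n⇒m<n∨m≡n (end-≥ t<n)
    ... | inj₂ t≡end = sym t≡end
    ... | inj₁ t<end = ⊥-elim (<-asym desc (ascent-in-fall t t<n t<end))

    b-ascends : ¬ Descent t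
    b-ascends = subst (λ e → ¬ Descent e) fall-ends-at-descent
      (end-ascent t<n (subst (λ e → suc e < n) (sym fall-ends-at-descent) st<n))

    next-fall-starts : start (suc t) ≡ suc t
    next-fall-starts = start-ascent t b-ascends

    a-at-start : a (start t) ≡ b t
    a-at-start with same-fall t<n (start t) ≤-refl (≤-trans (start-≤ t) (end-≥ t<n))
    ... | start≡ , end≡ = trans (a≡flip _ (≤-<-trans (start-≤ t) t<n))
      (cong b (begin
        start (start t) + end (start t) ∸ start t  ≡⟨ cong₂ (λ s e → s + e ∸ start t) start≡ (trans end≡ fall-ends-at-descent) ⟩
        start t + t ∸ start t                      ≡⟨ m+n∸m≡n (start t) t ⟩
        t                                          ∎))
      where open ≡-Reasoning

    a-at-end : a (end (suc t)) ≡ b (suc t)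
    a-at-end with same-fall st<n (end (suc t)) (subst (_≤ end (suc t)) (sym next-fall-starts) (end-≥ st<n)) ≤-refl
    ... | start≡ , end≡ = trans (a≡flip _ (end-< st<n))
      (cong b (begin
        start (end (suc t)) + end (end (suc t)) ∸ end (suc t) ≡⟨ cong₂ (λ s e → s + e ∸ end (suc t)) (trans start≡ next-fall-starts) end≡ ⟩
        suc t + end (suc t) ∸ end (suc t)                     ≡⟨ m+n∸n≡m (suc t) (end (suc t)) ⟩
        suc t                                                 ∎))
      where open ≡-Reasoning

    -- The witnesses: the start of the fall of t and the end of the fall of t+1.
    descent-straddles-falls : ∃ λ p → ∃ λ q → p < n × q < n ×
      dcount a p ≡ dcount a t × dcount a q ≡ dcount a (suc t) × a p < a q
    descent-straddles-falls =
      start t , end (suc t) , ≤-<-trans (start-≤ t) t<n , end-< st<n ,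
      dcount-constant-on-fall t<n ≤-refl (start-≤ t) (≤-reflexive (sym fall-ends-at-descent)) ,
      sym (dcount-constant-on-fall st<n (≤-reflexive next-fall-starts) (end-≥ st<n) ≤-refl) ,
      subst₂ _<_ (sym a-at-start) (sym a-at-end)
        (≤∧≢⇒< (≮⇒≥ b-ascends) (λ bt≡bst → <-irrefl (b-injective t<n st<n bt≡bst) (n<1+n t)))

lookupℕ : ∀ {n} → Vec ℕ n → ℕ → ℕ
lookupℕ {n} w x with x <? n
... | yes x<n = lookup w (fromℕ< x<n)
... | no _    = 0

lookupℕ-fromℕ< : ∀ {n} (w : Vec ℕ n) {x} (x<n : x < n) → lookupℕ w x ≡ lookup w (fromℕ< x<n)
lookupℕ-fromℕ< {n} w {x} x<n with x <? n
... | yes _  = refl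
... | no x≮n = ⊥-elim (x≮n x<n)

lookupℕ-toℕ : ∀ {n} (w : Vec ℕ n) (i : Fin n) → lookupℕ w (toℕ i) ≡ lookup w i
lookupℕ-toℕ w i = trans (lookupℕ-fromℕ< w (toℕ<n i)) (cong (lookup w) (fromℕ<-toℕ i _))

module _ {n : ℕ} (w : Vec ℕ n) where

  isWord⇒lettersIn : ∀ {k} → IsWord k w → LettersIn n k (lookupℕ w)
  isWord⇒lettersIn word v v<n rewrite lookupℕ-fromℕ< w v<n = word (fromℕ< v<n)

  precedes⇒precedesℕ : ∀ {x y} → Precedes w x y → Precedesℕ n (lookupℕ w) x y
  precedes⇒precedesℕ (p , q , p<q , wp≡x , wq≡y) =
    toℕ p , toℕ q , p<q , toℕ<n q , trans (lookupℕ-toℕ w p) wp≡x , trans (lookupℕ-toℕ w q) wq≡y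

  precedesℕ⇒precedes : ∀ {x y} → Precedesℕ n (lookupℕ w) x y → Precedes w x y
  precedesℕ⇒precedes (p , q , p<q , q<n , wp≡x , wq≡y) =
    fromℕ< (<-trans p<q q<n) , fromℕ< q<n ,
    subst₂ _<_ (sym (toℕ-fromℕ< (<-trans p<q q<n))) (sym (toℕ-fromℕ< q<n)) p<q ,
    trans (sym (lookupℕ-fromℕ< w (<-trans p<q q<n))) wp≡x , trans (sym (lookupℕ-fromℕ< w q<n)) wq≡y

module WordOfPermutation {n : ℕ} (π : Permutation′ n) where
  open OneLine π public
  open Descents (oneLine π) public

  private
    a : ℕ → ℕ
    a = oneLine π

  letter-of-entry : ∀ {p} → p < n → lookupℕ (word π) (a p) ≡ suc (dcount a p)
  letter-of-entry {p} p<n = begin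
    lookupℕ (word π) (a p)                        ≡⟨ cong (lookupℕ (word π)) (oneLine-fromℕ< p<n) ⟩
    lookupℕ (word π) (toℕ (π ⟨$⟩ʳ fromℕ< p<n))    ≡⟨ lookupℕ-toℕ (word π) _ ⟩
    lookup (word π) (π ⟨$⟩ʳ fromℕ< p<n)           ≡⟨ lookup∘tabulate (λ v → runIndex π (toℕ (π ⟨$⟩ˡ v))) _ ⟩
    runIndex π (toℕ (π ⟨$⟩ˡ (π ⟨$⟩ʳ fromℕ< p<n))) ≡⟨ cong (λ i → runIndex π (toℕ i)) (inverseˡ π) ⟩
    runIndex π (toℕ (fromℕ< p<n))                 ≡⟨ cong (runIndex π) (toℕ-fromℕ< p<n) ⟩
    suc (dcount a p)                              ∎
    where open ≡-Reasoning

  -- Sorting the values by their letters, ties increasingly, lists π: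
  -- inside a run a increases, and later runs carry larger letters.
  oneLine-sorted-by-word : Sorted (Key _<_ (lookupℕ (word π))) a n
  oneLine-sorted-by-word p q p<q q<n with m≤n⇒m<n∨m≡n (dcount-mono (<⇒≤ p<q))
  ... | inj₁ lt = inj₁ (subst₂ _<_ (sym (letter-of-entry p<n)) (sym (letter-of-entry q<n)) (s≤s lt))
    where p<n = <-trans p<q q<n
  ... | inj₂ same-run = inj₂ (trans (letter-of-entry p<n) (trans (cong suc same-run) (sym (letter-of-entry q<n))) ,
      same-run⇒< p<q same-run λ m m<q am≡asm →
        <-irrefl (oneLine-injective (<-trans m<q q<n) (≤-<-trans m<q q<n) am≡asm) (n<1+n m))
    where p<n = <-trans p<q q<n

  word-isWord : ∀ {k} → runs π ≡ k → IsWord k (word π)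
  word-isWord {k} runs≡k v rewrite lookup∘tabulate (λ v → runIndex π (toℕ (π ⟨$⟩ˡ v))) v =
    s≤s z≤n , subst (suc (dcount a (toℕ (π ⟨$⟩ˡ v))) ≤_) runs≡k (s≤s (dcount-mono (<⇒≤pred (toℕ<n (π ⟨$⟩ˡ v)))))

  descent-between-runs : ∀ {k} → 1 ≤ n → runs π ≡ k → ∀ c → suc (suc c) ≤ k →
    ∃ λ t → suc t < n × dcount a t ≡ c × a (suc t) < a t × dcount a (suc t) ≡ suc c
  descent-between-runs n≥1 runs≡k c ssc≤k
    with descent-at-level (n ∸ 1) c (≤-pred (subst (suc (suc c) ≤_) (sym runs≡k) ssc≤k))
  ... | t , t<n∸1 , rest = t , ≤-<-trans t<n∸1 (n∸1<n n≥1) , rest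

  -- The entry after the descent (letter c+2) precedes the one before it (letter c+1).
  word-downSteps : ∀ {k} → 1 ≤ n → runs π ≡ k → DownSteps n k (lookupℕ (word π))
  word-downSteps n≥1 runs≡k (suc c) _ ssc≤k with descent-between-runs n≥1 runs≡k c ssc≤k
  ... | t , st<n , dt≡c , desc , dst≡sc =
    a (suc t) , a t , desc , oneLine-mapsInto t (<-trans (n<1+n t) st<n) ,
    trans (letter-of-entry st<n) (cong suc dst≡sc) , trans (letter-of-entry (<-trans (n<1+n t) st<n)) (cong suc dt≡c)

-- (1) A permutation is determined by its word: both one-line notations are
-- the enumeration of {0,…,n-1} sorted by (letter, value).
word-injective : ∀ {n} (π σ : Permutation′ n) → word π ≡ word σ → ∀ i → π ⟨$⟩ʳ i ≡ σ ⟨$⟩ʳ i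
word-injective {n} π σ same-word i = toℕ-injective (begin
  toℕ (π ⟨$⟩ʳ i)      ≡⟨ Π.oneLine-toℕ i ⟨
  oneLine π (toℕ i)   ≡⟨ same-oneLine (toℕ i) (toℕ<n i) ⟩
  oneLine σ (toℕ i)   ≡⟨ Σ′.oneLine-toℕ i ⟩
  toℕ (σ ⟨$⟩ʳ i)      ∎)
  where
  open ≡-Reasoning
  module Π = WordOfPermutation π
  module Σ′ = WordOfPermutation σ
  σ-sorted : Sorted (Key _<_ (lookupℕ (word π))) (oneLine σ) n
  σ-sorted = subst (λ w → Sorted (Key _<_ (lookupℕ w)) (oneLine σ) n) (sym same-word) Σ′.oneLine-sorted-by-word
  same-oneLine : ∀ p → p < n → oneLine π p ≡ oneLine σ p
  same-oneLine = SortedEnumeration.sorted-enumeration-unique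
    (key-isStrictTotalOrder <-isStrictTotalOrder (lookupℕ (word π)))
    Π.oneLine-sorted-by-word Π.oneLine-mapsInto Π.oneLine-onto σ-sorted Σ′.oneLine-mapsInto Σ′.oneLine-onto

word-satisfies-cond2 : ∀ {n k} → 1 ≤ n → (π : Permutation′ n) → runs π ≡ k → IsWord k (word π) × Cond2 k (word π)
word-satisfies-cond2 n≥1 π runs≡k = word-isWord runs≡k ,
  λ j 1≤j sj≤k → precedesℕ⇒precedes (word π) (word-downSteps n≥1 runs≡k j 1≤j sj≤k)
  where open WordOfPermutation π

popStacked-word-satisfies-cond3 : ∀ {n k} → 1 ≤ n → (π : Permutation′ n) → PopStacked π → runs π ≡ k →
  IsWord k (word π) × Cond3 k (word π)
popStacked-word-satisfies-cond3 {n} {k} n≥1 π (σ , π≡flip) runs≡k =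
  proj₁ (word-satisfies-cond2 n≥1 π runs≡k) ,
  λ j 1≤j sj≤k → proj₂ (word-satisfies-cond2 n≥1 π runs≡k) j 1≤j sj≤k , up-step j 1≤j sj≤k
  where
  open WordOfPermutation π
  -- the descent leaving run c+1 straddles two falls of σ, giving an entry
  -- of run c+1 smaller than an entry of run c+2
  up-step : ∀ j → 1 ≤ j → suc j ≤ k → Precedes (word π) j (suc j)
  up-step (suc c) _ ssc≤k with descent-between-runs n≥1 runs≡k c ssc≤k
  ... | t , st<n , dt≡c , desc , dst≡sc
    with RunsOfFlip.descent-straddles-falls n (oneLine π) (oneLine σ) π≡flip
           (OneLine.oneLine-injective σ) st<n desc
  ...   | p , q , p<n , q<n , dp≡dt , dq≡dst , ap<aq =
    precedesℕ⇒precedes (word π) (oneLine π p , oneLine π q , ap<aq , oneLine-mapsInto q q<n ,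
      trans (letter-of-entry p<n) (cong suc (trans dp≡dt dt≡c)) ,
      trans (letter-of-entry q<n) (cong suc (trans dq≡dst dst≡sc)))

word-from-runIndices : ∀ {n} (P : Permutation′ n) (u : Vec ℕ n) →
  (∀ p → p < n → runIndex P p ≡ lookupℕ u (oneLine P p)) → word P ≡ u
word-from-runIndices P u runIndex≡letter = trans (tabulate-cong letter-at) (tabulate∘lookup u)
  where
  letter-at : ∀ v → runIndex P (toℕ (P ⟨$⟩ˡ v)) ≡ lookup u v
  letter-at v = begin
    runIndex P (toℕ (P ⟨$⟩ˡ v))          ≡⟨ runIndex≡letter _ (toℕ<n _) ⟩
    lookupℕ u (oneLine P (toℕ (P ⟨$⟩ˡ v))) ≡⟨ cong (lookupℕ u) (OneLine.oneLine-toℕ P _) ⟩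
    lookupℕ u (toℕ (P ⟨$⟩ʳ (P ⟨$⟩ˡ v)))    ≡⟨ cong (λ i → lookupℕ u (toℕ i)) (inverseʳ P) ⟩
    lookupℕ u (toℕ v)                      ≡⟨ lookupℕ-toℕ u v ⟩
    lookup u v                             ∎
    where open ≡-Reasoning

-- The inverse construction: list the values sorted by (letter, value),
-- ties increasingly (the preimage of u) or decreasingly (its pop-stack source).
module FromWord {n k : ℕ} (n≥1 : 1 ≤ n) (k≥1 : 1 ≤ k) (u : Vec ℕ n) (u-word : IsWord k u) (u-cond2 : Cond2 k u) where

  private
    letter : ℕ → ℕ
    letter = lookupℕ u

    module Up   = SortingPermutation (key-isStrictTotalOrder <-isStrictTotalOrder letter) n
    module Down = SortingPermutation (key-isStrictTotalOrder >-isStrictTotalOrder letter) n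

    u-down : DownSteps n k letter
    u-down j 1≤j sj≤k = precedes⇒precedesℕ u (u-cond2 j 1≤j sj≤k)

  preimage : Permutation′ n
  preimage = Up.sortingPermutation

  private
    module R = RunsOfSortedWord letter (oneLine preimage) n≥1 Up.sortingPermutation-sorted
      (OneLine.oneLine-mapsInto preimage) (OneLine.oneLine-onto preimage) (isWord⇒lettersIn u u-word) u-down

  preimage-runs : runs preimage ≡ k
  preimage-runs = trans (R.runIndex≡letter (n ∸ 1) (n∸1<n n≥1)) (R.last-letter k≥1)

  preimage-word : word preimage ≡ u
  preimage-word = word-from-runIndices preimage u R.runIndex≡letter

  -- Under Cond3 the preimage is the flip of the decreasing tie-break.
  preimage-popStacked : UpSteps n k letter → PopStacked preimage
  preimage-popStacked u-up = Down.sortingPermutation ,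
    FlipOfSortedWord.a≡flip letter (oneLine preimage) (oneLine Down.sortingPermutation) n≥1
      Up.sortingPermutation-sorted (OneLine.oneLine-mapsInto preimage) (OneLine.oneLine-onto preimage)
      Down.sortingPermutation-sorted (OneLine.oneLine-mapsInto Down.sortingPermutation)
      (OneLine.oneLine-onto Down.sortingPermutation) (isWord⇒lettersIn u u-word) u-down u-up

-- The proposition: (1) needs no hypothesis on the runs, (3) and (5) use the
-- construction FromWord, the latter with the UpSteps half of Cond3.
proposition4 : ∀ (n k : ℕ) → 1 ≤ n → 1 ≤ k →
    ((π σ : Permutation′ n) → runs π ≡ k → runs σ ≡ k →
       word π ≡ word σ → ∀ i → π ⟨$⟩ʳ i ≡ σ ⟨$⟩ʳ i)
    × ((π : Permutation′ n) → runs π ≡ k → IsWord k (word π) × Cond2 k (word π))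
    × ((u : Vec ℕ n) → IsWord k u → Cond2 k u →
       ∃ λ (π : Permutation′ n) → runs π ≡ k × word π ≡ u)
    × ((π : Permutation′ n) → PopStacked π → runs π ≡ k →
       IsWord k (word π) × Cond3 k (word π))
    × ((u : Vec ℕ n) → IsWord k u → Cond3 k u →
       ∃ λ (π : Permutation′ n) → PopStacked π × runs π ≡ k × word π ≡ u)
proposition4 n k n≥1 k≥1 =
  (λ π σ _ _ → word-injective π σ) ,
  word-satisfies-cond2 n≥1 ,
  (λ u u-word u-cond2 → let open FromWord n≥1 k≥1 u u-word u-cond2 in
    preimage , preimage-runs , preimage-word) ,
  popStacked-word-satisfies-cond3 n≥1 ,
  (λ u u-word u-cond3 →
    let open FromWord n≥1 k≥1 u u-word (λ j 1≤j sj≤k → proj₁ (u-cond3 j 1≤j sj≤k))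
        u-up : UpSteps n k (lookupℕ u)
        u-up j 1≤j sj≤k = precedes⇒precedesℕ u (proj₂ (u-cond3 j 1≤j sj≤k))
    in preimage , preimage-popStacked u-up , preimage-runs , preimage-word)
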